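{- In the typing system $\lambda\mathbf A$: (1) If $\bullet\Gamma_1\cup\Gamma_2$ is a well-formed typing context and $\Gamma_1\vdash M:A$ is derivable, then $\bullet\Gamma_1\cup\Gamma_2\vdash M:\bullet A$ is derivable. (2) If $\Gamma_1\cup\Gamma_2$ is a well-formed typing context and both $\Gamma_1\cup\{x:A\}\vdash M:B$ and $\Gamma_2\vdash N:A$ are derivable, then $\Gamma_1\cup\Gamma_2\vdash M[N/x]:B$ is derivable.
   Context: Type expressions. Pseudo type expressions: $A::=X\mid A\to B\mid\bullet A\mid\mu X.A$ ($\alpha$-equivalent ones identified; $A[B/X]$ capture-avoiding substitution). $\top:=\mu X.\bullet X$. Tail: $t(X)=X$, $t(A\to B)=t(B)$, $t(\bullet A)=\bullet t(A)$, $t(\mu X.A)=\mu X.t(A)$. $A$ is a $\top$-variant iff $t(A)=\bullet^{m_0}\mu X_1.\bullet^{m_1}\cdots\mu X_n.\bullet^{m_n}X_i$ with $1\le i\le n$, $X_i\notin\{X_{i+1},\dots,X_n\}$, $m_i+\dots+m_n\ge1$. Properness in $X$: variable $Y$ iff $Y\ne X$; $\bullet A$ always; $A\to B$ iff both are or $B$ is a $\top$-variant; $\mu Y.A$ ($Y\ne X$) iff $A$ is or $\mu Y.A$ is a $\top$-variant. Type expressions: every $\mu X.A$ has $A$ proper in $X$. Equality $\simeq$: smallest relation closed under reflexivity, symmetry, transitivity, $\bullet$- and $\to$-congruence, $A\to\top\simeq\top$, $\mu X.A\simeq A[\mu X.A/X]$, ($A\simeq C[A/X]$, $C$ proper in $X$)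 $\Rightarrow A\simeq\mu X.C$, and $\bullet(A\to B)\simeq\bullet A\to\bullet B$. $A\preceq B$ means $\emptyset\vdash A\preceq B$ is derivable, where $\gamma$ ranges over finite sets of pairs $X\preceq Y$ of type variables each variable occurring at most once, by: $\gamma\cup\{X\preceq Y\}\vdash X\preceq Y$; $\gamma\vdash A\preceq\top$; $A\simeq B\Rightarrow\gamma\vdash A\preceq B$; transitivity (union of assumptions); $\bullet$-monotonicity; $\gamma_1\vdash A'\preceq A$, $\gamma_2\vdash B\preceq B'\Rightarrow\gamma_1\cup\gamma_2\vdash A\to B\preceq A'\to B'$; $\gamma\cup\{X\preceq Y\}\vdash A\preceq B\Rightarrow\gamma\vdash\mu X.A\preceq\mu Y.B$ if $X$ not free in $\gamma,B$, $Y$ not free in $\gamma,A$, $A$ proper in $X$, $B$ proper in $Y$; $\gamma\vdash A\preceq\bullet A$. Typing system $\lambda\mathbf A$: typing contexts are finite maps from individual variables to type expressions; $\bullet\Gamma$ maps $x\mapsto\bullet\Gamma(x)$; a union of contexts is well-formed if they agree on common variables. Rules: $\Gamma\cup\{x:A\}\vdash x:A$; from $\bullet\Gamma\vdash M:\bullet A$ infer $\Gamma\vdash M:A$; $\Gamma\vdash M:\top$; from $\Gamma\vdash M:A$ and $A\preceq B$ infer $\Gamma\vdash M:B$; from $\Gamma\cup\{x:A\}\vdash M:B$ infer $\Gamma\vdash\lambda x.M:A\to B$; from $\Gamma_1\vdash M:A\to B$ and $\Gamma_2\vdash N:A$ infer $\Gamma_1\cup\Gamma_2\vdash MN:B$.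 -}

module Defs where

-- Locally nameless encoding of the type system λA.
-- Free (type / term) variables are names (ℕ); bound variables are de Bruijn
-- indices, so α-equivalent expressions are literally equal.

open import Data.Nat using (ℕ; zero; suc; _<_; _≡ᵇ_)
open import Data.Bool using (Bool; true; false; if_then_else_)
open import Data.List using (List; []; _∷_; _++_; map)
open import Data.List.Membership.Propositional using (_∈_)
open import Data.Maybe using (Maybe; just; nothing)
open import Data.Product using (_×_; _,_; Σ; proj₁; proj₂; map₂)
open import Data.Sum using (_⊎_)
open import Data.Unit using (⊤)
open import Relation.Binary.PropositionalEquality using (_≡_; _≢_)
open import Relation.Nullary using (¬_)

infixr 30 _⇒_
infix 40 •_

data Ty : Set where
  fvT : ℕ → Ty
  bvT : ℕ → Ty
  _⇒_ : Ty → Ty → Ty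
  •_  : Ty → Ty
  μ_  : Ty → Ty         -- μ binds index 0 in its body

Top : Ty
Top = μ (• bvT 0)

-- A[U/X] where X is the bound variable with index k (U locally closed)
openTyAt : ℕ → Ty → Ty → Ty
openTyAt k U (fvT X) = fvT X
openTyAt k U (bvT j) = if j ≡ᵇ k then U else bvT j
openTyAt k U (A ⇒ B) = openTyAt k U A ⇒ openTyAt k U B
openTyAt k U (• A)   = • openTyAt k U A
openTyAt k U (μ A)   = μ openTyAt (suc k) U A

openTy : Ty → Ty → Ty
openTy C U = openTyAt 0 U C

data FreeInTy (X : ℕ) : Ty → Set where
  fv-var : FreeInTy X (fvT X)
  fv-⇒ˡ  : ∀ {A B} → FreeInTy X A → FreeInTy X (A ⇒ B)
  fv-⇒ʳ  : ∀ {A B} → FreeInTy X B → FreeInTy X (A ⇒ B)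
  fv-•   : ∀ {A} → FreeInTy X A → FreeInTy X (• A)
  fv-μ   : ∀ {A} → FreeInTy X A → FreeInTy X (μ A)

tailTy : Ty → Ty
tailTy (fvT X) = fvT X
tailTy (bvT j) = bvT j
tailTy (A ⇒ B) = tailTy B
tailTy (• A)   = • tailTy A
tailTy (μ A)   = μ tailTy A

-- `marks` records, for each μ of the chain •^{m0} μX1 •^{m1} ... μXn (innermost
-- first), whether at least one • occurs after it.
data Marked : List Bool → ℕ → Set where
  here  : ∀ {bs} → Marked (true ∷ bs) zero
  there : ∀ {b bs i} → Marked bs i → Marked (b ∷ bs) (suc i)

allTrue : List Bool → List Bool
allTrue = map (λ _ → true)

-- TopChain bs A : A has the shape •^{m} μ •^{m'} ... μ •^{..} X_i where X_i is
-- bound by one of the μ's of the chain (or of the enclosing chain recorded in bs)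
-- and is followed by at least one • .  (De Bruijn indices automatically make
-- X_i the binder not shadowed by later X_{i+1},…,X_n.)
data TopChain : List Bool → Ty → Set where
  tc-var : ∀ {bs i} → Marked bs i → TopChain bs (bvT i)
  tc-•   : ∀ {bs A} → TopChain (allTrue bs) A → TopChain bs (• A)
  tc-μ   : ∀ {bs A} → TopChain (false ∷ bs) A → TopChain bs (μ A)

TopVariant : Ty → Set
TopVariant A = TopChain [] (tailTy A)

data Proper : ℕ → Ty → Set where
  pr-fvar : ∀ {k X} → Proper k (fvT X)
  pr-bvar : ∀ {k j} → j ≢ k → Proper k (bvT j)
  pr-•    : ∀ {k A} → Proper k (• A)
  pr-⇒    : ∀ {k A B} → Proper k A → Proper k B → Proper k (A ⇒ B)
  pr-⇒⊤   : ∀ {k A B} → TopVariant B → Proper k (A ⇒ B)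
  pr-μ    : ∀ {k A} → Proper (suc k) A → Proper k (μ A)
  pr-μ⊤   : ∀ {k A} → TopVariant (μ A) → Proper k (μ A)

data WF : ℕ → Ty → Set where
  wf-fvar : ∀ {k X} → WF k (fvT X)
  wf-bvar : ∀ {k j} → j < k → WF k (bvT j)
  wf-⇒    : ∀ {k A B} → WF k A → WF k B → WF k (A ⇒ B)
  wf-•    : ∀ {k A} → WF k A → WF k (• A)
  wf-μ    : ∀ {k A} → WF (suc k) A → Proper 0 A → WF k (μ A)

IsType : Ty → Set
IsType = WF 0

infix 4 _≃_

data _≃_ : Ty → Ty → Set where
  ≃-refl  : ∀ {A} → IsType A → A ≃ A
  ≃-sym   : ∀ {A B} → A ≃ B → B ≃ A
  ≃-trans : ∀ {A B C} → A ≃ B → B ≃ C → A ≃ C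
  ≃-•     : ∀ {A B} → A ≃ B → • A ≃ • B
  ≃-⇒     : ∀ {A A' B B'} → A ≃ A' → B ≃ B' → (A ⇒ B) ≃ (A' ⇒ B')
  ≃-⇒⊤    : ∀ {A} → IsType A → (A ⇒ Top) ≃ Top
  ≃-unfold : ∀ {A} → IsType (μ A) → μ A ≃ openTy A (μ A)
  ≃-fold  : ∀ {A C} → IsType A → IsType (μ C) →   -- IsType (μ C) includes: C proper in X
            A ≃ openTy C A → A ≃ μ C
  ≃-•⇒    : ∀ {A B} → IsType A → IsType B → • (A ⇒ B) ≃ (• A ⇒ • B)

-- assumption sets γ, as lists of pairs (X , Y) meaning X ⪯ Y, read as finite sets
Assm : Set
Assm = List (ℕ × ℕ)

OccursIn : ℕ → Assm → Set
OccursIn X γ = Σ ℕ (λ Y → ((X , Y) ∈ γ) ⊎ ((Y , X) ∈ γ))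

IsUnion : Assm → Assm → Assm → Set
IsUnion γ γ₁ γ₂ = ∀ p → (p ∈ γ → p ∈ γ₁ ⊎ p ∈ γ₂) × (p ∈ γ₁ ⊎ p ∈ γ₂ → p ∈ γ)

infix 3 _⊢_⪯_

data _⊢_⪯_ : Assm → Ty → Ty → Set where
  ⪯-hyp   : ∀ {γ X Y} → (X , Y) ∈ γ → γ ⊢ fvT X ⪯ fvT Y
  ⪯-top   : ∀ {γ A} → IsType A → γ ⊢ A ⪯ Top
  ⪯-eq    : ∀ {γ A B} → A ≃ B → γ ⊢ A ⪯ B
  ⪯-trans : ∀ {γ γ₁ γ₂ A B C} → γ₁ ⊢ A ⪯ B → γ₂ ⊢ B ⪯ C → IsUnion γ γ₁ γ₂ → γ ⊢ A ⪯ C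
  ⪯-•     : ∀ {γ A B} → γ ⊢ A ⪯ B → γ ⊢ • A ⪯ • B
  ⪯-⇒     : ∀ {γ γ₁ γ₂ A A' B B'} → γ₁ ⊢ A' ⪯ A → γ₂ ⊢ B ⪯ B' → IsUnion γ γ₁ γ₂ →
            γ ⊢ (A ⇒ B) ⪯ (A' ⇒ B')
  -- μX.A ⪯ μY.B, with X , Y fresh (X ≠ Y, neither free in γ, A, B);
  -- IsType (μ A), IsType (μ B) include: A proper in X, B proper in Y
  ⪯-μ     : ∀ {γ A B} (X Y : ℕ) → X ≢ Y →
            ¬ OccursIn X γ → ¬ FreeInTy X A → ¬ FreeInTy X B →
            ¬ OccursIn Y γ → ¬ FreeInTy Y A → ¬ FreeInTy Y B →
            IsType (μ A) → IsType (μ B) →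
            ((X , Y) ∷ γ) ⊢ openTy A (fvT X) ⪯ openTy B (fvT Y) →
            γ ⊢ μ A ⪯ μ B
  ⪯-next  : ∀ {γ A} → IsType A → γ ⊢ A ⪯ • A

infix 4 _⪯_
_⪯_ : Ty → Ty → Set
A ⪯ B = [] ⊢ A ⪯ B

infixl 20 _·_

data Tm : Set where
  fv  : ℕ → Tm
  bv  : ℕ → Tm
  ƛ_  : Tm → Tm
  _·_ : Tm → Tm → Tm

openTmAt : ℕ → ℕ → Tm → Tm
openTmAt k x (fv y)  = fv y
openTmAt k x (bv j)  = if j ≡ᵇ k then fv x else bv j
openTmAt k x (ƛ M)   = ƛ openTmAt (suc k) x M
openTmAt k x (M · N) = openTmAt k x M · openTmAt k x N

openTm : Tm → ℕ → Tm
openTm M x = openTmAt 0 x M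

substTm : ℕ → Tm → Tm → Tm
substTm x N (fv y)  = if y ≡ᵇ x then N else fv y
substTm x N (bv j)  = bv j
substTm x N (ƛ M)   = ƛ substTm x N M
substTm x N (M · M') = substTm x N M · substTm x N M'

data FreeInTm (x : ℕ) : Tm → Set where
  fv-var : FreeInTm x (fv x)
  fv-ƛ   : ∀ {M} → FreeInTm x M → FreeInTm x (ƛ M)
  fv-·ˡ  : ∀ {M N} → FreeInTm x M → FreeInTm x (M · N)
  fv-·ʳ  : ∀ {M N} → FreeInTm x N → FreeInTm x (M · N)

data LCTm : ℕ → Tm → Set where
  lc-fv : ∀ {k x} → LCTm k (fv x)
  lc-bv : ∀ {k j} → j < k → LCTm k (bv j)
  lc-ƛ  : ∀ {k M} → LCTm (suc k) M → LCTm k (ƛ M)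
  lc-·  : ∀ {k M N} → LCTm k M → LCTm k N → LCTm k (M · N)

-- Typing contexts: finite maps, as association lists (first binding wins)

Ctx : Set
Ctx = List (ℕ × Ty)

lookupCtx : Ctx → ℕ → Maybe Ty
lookupCtx []             x = nothing
lookupCtx ((y , A) ∷ Γ) x = if y ≡ᵇ x then just A else lookupCtx Γ x

-- Γ₁ ∪ Γ₂ (as maps; meaningful when Compatible Γ₁ Γ₂)
_∪_ : Ctx → Ctx → Ctx
Γ₁ ∪ Γ₂ = Γ₁ ++ Γ₂

⟦_∶_⟧ : ℕ → Ty → Ctx
⟦ x ∶ A ⟧ = (x , A) ∷ []

•ctx : Ctx → Ctx
•ctx = map (map₂ •_)

-- Γ₁ ∪ Γ₂ is well-formed: Γ₁ and Γ₂ agree on common variables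
Compatible : Ctx → Ctx → Set
Compatible Γ₁ Γ₂ = ∀ x {A B} → lookupCtx Γ₁ x ≡ just A → lookupCtx Γ₂ x ≡ just B → A ≡ B

ValidCtx : Ctx → Set
ValidCtx Γ = ∀ x {A} → lookupCtx Γ x ≡ just A → IsType A

_≋_ : Ctx → Ctx → Set
Γ ≋ Δ = ∀ x → lookupCtx Γ x ≡ lookupCtx Δ x

infix 3 _⊢_∶_

data _⊢_∶_ : Ctx → Tm → Ty → Set where
  ty-var : ∀ {Γ x A} → lookupCtx Γ x ≡ just A → Γ ⊢ fv x ∶ A
  ty-•   : ∀ {Γ M A} → •ctx Γ ⊢ M ∶ • A → Γ ⊢ M ∶ A
  ty-top : ∀ {Γ M} → LCTm 0 M → Γ ⊢ M ∶ Top
  ty-sub : ∀ {Γ M A B} → Γ ⊢ M ∶ A → A ⪯ B → Γ ⊢ M ∶ B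
  -- λx.M with the bound variable named x (x not free in λx.M, Γ ∪ {x:A} well-formed)
  ty-ƛ   : ∀ {Γ M A B} (x : ℕ) → ¬ FreeInTm x M → IsType A →
           Compatible Γ ⟦ x ∶ A ⟧ →
           (Γ ∪ ⟦ x ∶ A ⟧) ⊢ openTm M x ∶ B → Γ ⊢ ƛ M ∶ A ⇒ B
  ty-·   : ∀ {Γ Γ₁ Γ₂ M N A B} → Γ₁ ⊢ M ∶ A ⇒ B → Γ₂ ⊢ N ∶ A →
           Compatible Γ₁ Γ₂ → Γ ≋ (Γ₁ ∪ Γ₂) → Γ ⊢ M · N ∶ B

module Submission where

-- The λ-rule fixes a NAME for its bound variable, which may
-- clash with a larger target context or with the free variables of N, so the
-- structural lemmas are proved for an arbitrary injective renaming σ of the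
-- term; under a binder the induction continues with σ followed by the
-- transposition of the old name with a fresh one (`rebind`):
--   * rename:       Γ ⊢ M : A ⇒ Δ ⊢ σM : A when σ transports Γ into Δ
--                   (weakening is the case σ = id);
--   * delay:        Γ ⊢ M : A ⇒ •Γ ⊢ M : •A, via •(A → B) ≃ •A → •B;
--   * subst-rename: Ξ ⊢ M : B, Ξ(x) = A, Θ ⊢ N : A ⇒ Θ ⊢ (σM)[N/σx] : B.  The theorem is then
-- delay, respectively substitution, followed by weakening.

open import Defs
open import Data.Nat using (ℕ; suc; _<_; _≤_; _≡ᵇ_; _+_; z≤n; s≤s)
open import Data.Nat.Properties
  using (_≟_; ≤-trans; ≤-<-trans; m≤m+n; m≤n+m; ≤∧≢⇒<; ≤-pred; <⇒≢; ≤-refl; <⇒≤)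
open import Data.Bool using (true; false; if_then_else_)
open import Data.List using ([]; _∷_; length)
open import Data.List.Properties using (map-++; length-map)
open import Data.Maybe using (just; nothing)
import Data.Maybe as Maybe
open import Data.Maybe.Properties using (just-injective)
open import Data.Product using (_×_; _,_; ∃; proj₁; proj₂; map₂)
open import Data.Sum using (_⊎_; inj₁; inj₂)
import Data.Sum as Sum
open import Data.Empty using (⊥-elim)
open import Data.Unit using (tt) renaming (⊤ to Unit)
open import Function using (_∘_; id)
open import Function.Definitions using (Injective)
open import Relation.Binary.PropositionalEquality
open import Relation.Nullary using (¬_; yes; no; Reflects; ofʸ; ofⁿ; proof)

≡ᵇ-reflects : ∀ m n → Reflects (m ≡ n) (m ≡ᵇ n)
≡ᵇ-reflects m n = proof (m ≟ n)

≡ᵇ-refl : ∀ n → (n ≡ᵇ n) ≡ true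
≡ᵇ-refl n with n ≡ᵇ n | ≡ᵇ-reflects n n
... | true  | _        = refl
... | false | ofⁿ n≢n = ⊥-elim (n≢n refl)

≡ᵇ-≢ : ∀ {m n} → m ≢ n → (m ≡ᵇ n) ≡ false
≡ᵇ-≢ {m} {n} m≢n with m ≡ᵇ n | ≡ᵇ-reflects m n
... | true  | ofʸ m≡n = ⊥-elim (m≢n m≡n)
... | false | _        = refl

InjectiveRenaming : (ℕ → ℕ) → Set
InjectiveRenaming = Injective _≡_ _≡_

transpose : ℕ → ℕ → ℕ → ℕ
transpose a b z = if z ≡ᵇ a then b else (if z ≡ᵇ b then a else z)

transpose-left : ∀ a b → transpose a b a ≡ b
transpose-left a b rewrite ≡ᵇ-refl a = refl

transpose-right : ∀ a b → transpose a b b ≡ a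
transpose-right a b with b ≡ᵇ a | ≡ᵇ-reflects b a
... | true  | ofʸ b≡a = b≡a
... | false | _        rewrite ≡ᵇ-refl b = refl

transpose-other : ∀ {a b z} → z ≢ a → z ≢ b → transpose a b z ≡ z
transpose-other z≢a z≢b rewrite ≡ᵇ-≢ z≢a | ≡ᵇ-≢ z≢b = refl

transpose-involutive : ∀ a b z → transpose a b (transpose a b z) ≡ z
transpose-involutive a b z with z ≟ a | z ≟ b
... | yes refl | _        = trans (cong (transpose z b) (transpose-left z b)) (transpose-right z b)
... | no _     | yes refl = trans (cong (transpose a z) (transpose-right a z)) (transpose-left a z)
... | no z≢a   | no z≢b   =
  trans (cong (transpose a b) (transpose-other z≢a z≢b)) (transpose-other z≢a z≢b)

transpose-injective : ∀ a b → InjectiveRenaming (transpose a b)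
transpose-injective a b {z} {w} e =
  trans (sym (transpose-involutive a b z))
        (trans (cong (transpose a b) e) (transpose-involutive a b w))

-- The renaming used under a binder named a whose new name is b:
-- first σ, then exchange σ a with b.
rebind : (ℕ → ℕ) → ℕ → ℕ → ℕ → ℕ
rebind σ a b = transpose (σ a) b ∘ σ

rebind-injective : ∀ {σ} a b → InjectiveRenaming σ → InjectiveRenaming (rebind σ a b)
rebind-injective {σ} a b σ-inj = σ-inj ∘ transpose-injective (σ a) b

renTm : (ℕ → ℕ) → Tm → Tm
renTm σ (fv y)  = fv (σ y)
renTm σ (bv j)  = bv j
renTm σ (ƛ M)   = ƛ renTm σ M
renTm σ (M · N) = renTm σ M · renTm σ N

renTm-openTmAt : ∀ σ k x M → renTm σ (openTmAt k x M) ≡ openTmAt k (σ x) (renTm σ M)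
renTm-openTmAt σ k x (fv y) = refl
renTm-openTmAt σ k x (bv j) with j ≡ᵇ k
... | true  = refl
... | false = refl
renTm-openTmAt σ k x (ƛ M)   = cong ƛ_ (renTm-openTmAt σ (suc k) x M)
renTm-openTmAt σ k x (M · N) = cong₂ _·_ (renTm-openTmAt σ k x M) (renTm-openTmAt σ k x N)

renTm-∘ : ∀ f g M → renTm f (renTm g M) ≡ renTm (f ∘ g) M
renTm-∘ f g (fv y)  = refl
renTm-∘ f g (bv j)  = refl
renTm-∘ f g (ƛ M)   = cong ƛ_ (renTm-∘ f g M)
renTm-∘ f g (M · N) = cong₂ _·_ (renTm-∘ f g M) (renTm-∘ f g N)

renTm-fix : ∀ f M → (∀ z → FreeInTm z M → f z ≡ z) → renTm f M ≡ M
renTm-fix f (fv y)  fixes = cong fv (fixes y fv-var)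
renTm-fix f (bv j)  fixes = refl
renTm-fix f (ƛ M)   fixes = cong ƛ_ (renTm-fix f M (λ z → fixes z ∘ fv-ƛ))
renTm-fix f (M · N) fixes =
  cong₂ _·_ (renTm-fix f M (λ z → fixes z ∘ fv-·ˡ)) (renTm-fix f N (λ z → fixes z ∘ fv-·ʳ))

renTm-id : ∀ M → renTm id M ≡ M
renTm-id M = renTm-fix id M (λ _ _ → refl)

free-fv : ∀ {z y} → FreeInTm z (fv y) → z ≡ y
free-fv fv-var = refl

free-renTm : ∀ {σ z} M → FreeInTm z M → FreeInTm (σ z) (renTm σ M)
free-renTm (fv y)  fv-var     = fv-var
free-renTm (ƛ M)   (fv-ƛ f)  = fv-ƛ (free-renTm M f)
free-renTm (M · N) (fv-·ˡ f) = fv-·ˡ (free-renTm M f)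
free-renTm (M · N) (fv-·ʳ f) = fv-·ʳ (free-renTm N f)

free-renTm⁻¹ : ∀ {σ z} → InjectiveRenaming σ → ∀ M → FreeInTm (σ z) (renTm σ M) → FreeInTm z M
free-renTm⁻¹ σ-inj (fv y) f = subst (λ w → FreeInTm w (fv y)) (sym (σ-inj (free-fv f))) fv-var
free-renTm⁻¹ σ-inj (ƛ M)   (fv-ƛ f)  = fv-ƛ (free-renTm⁻¹ σ-inj M f)
free-renTm⁻¹ σ-inj (M · N) (fv-·ˡ f) = fv-·ˡ (free-renTm⁻¹ σ-inj M f)
free-renTm⁻¹ σ-inj (M · N) (fv-·ʳ f) = fv-·ʳ (free-renTm⁻¹ σ-inj N f)

free-openTmAt : ∀ {z} k y M → FreeInTm z (openTmAt k y M) → z ≡ y ⊎ FreeInTm z M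
free-openTmAt k y (fv x) fv-var = inj₂ fv-var
free-openTmAt k y (bv j) f with j ≡ᵇ k
free-openTmAt k y (bv j) fv-var | true = inj₁ refl
free-openTmAt k y (bv j) ()     | false
free-openTmAt k y (ƛ M) (fv-ƛ f) = Sum.map₂ fv-ƛ (free-openTmAt (suc k) y M f)
free-openTmAt k y (M · N) (fv-·ˡ f) = Sum.map₂ fv-·ˡ (free-openTmAt k y M f)
free-openTmAt k y (M · N) (fv-·ʳ f) = Sum.map₂ fv-·ʳ (free-openTmAt k y N f)

free-substTm : ∀ {z x N} M → FreeInTm z (substTm x N M) → FreeInTm z M ⊎ FreeInTm z N
free-substTm {x = x} (fv y) f with y ≡ᵇ x
free-substTm (fv y) f      | true  = inj₂ f
free-substTm (fv y) fv-var | false = inj₁ fv-var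
free-substTm (ƛ M)    (fv-ƛ f)  = Sum.map₁ fv-ƛ (free-substTm M f)
free-substTm (M · M') (fv-·ˡ f) = Sum.map₁ fv-·ˡ (free-substTm M f)
free-substTm (M · M') (fv-·ʳ f) = Sum.map₁ fv-·ʳ (free-substTm M' f)

substTm-nonfree : ∀ {x N} M → ¬ FreeInTm x M → substTm x N M ≡ M
substTm-nonfree {x} (fv y) x∉M with y ≡ᵇ x | ≡ᵇ-reflects y x
... | true  | ofʸ refl = ⊥-elim (x∉M fv-var)
... | false | _        = refl
substTm-nonfree (bv j)   x∉M = refl
substTm-nonfree (ƛ M)    x∉M = cong ƛ_ (substTm-nonfree M (x∉M ∘ fv-ƛ))
substTm-nonfree (M · M') x∉M =
  cong₂ _·_ (substTm-nonfree M (x∉M ∘ fv-·ˡ)) (substTm-nonfree M' (x∉M ∘ fv-·ʳ))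

lc-weaken : ∀ {k k' M} → k ≤ k' → LCTm k M → LCTm k' M
lc-weaken k≤k' lc-fv        = lc-fv
lc-weaken k≤k' (lc-bv j<k)  = lc-bv (≤-trans j<k k≤k')
lc-weaken k≤k' (lc-ƛ l)     = lc-ƛ (lc-weaken (s≤s k≤k') l)
lc-weaken k≤k' (lc-· l l')  = lc-· (lc-weaken k≤k' l) (lc-weaken k≤k' l')

lc-renTm : ∀ {σ k M} → LCTm k M → LCTm k (renTm σ M)
lc-renTm lc-fv       = lc-fv
lc-renTm (lc-bv p)   = lc-bv p
lc-renTm (lc-ƛ l)    = lc-ƛ (lc-renTm l)
lc-renTm (lc-· l l') = lc-· (lc-renTm l) (lc-renTm l')

lc-openTmAt⁻¹ : ∀ k x M → LCTm k (openTmAt k x M) → LCTm (suc k) M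
lc-openTmAt⁻¹ k x (fv y) l = lc-fv
lc-openTmAt⁻¹ k x (bv j) l with j ≡ᵇ k | ≡ᵇ-reflects j k
... | true  | ofʸ refl = lc-bv ≤-refl
lc-openTmAt⁻¹ k x (bv j) (lc-bv j<k) | false | _ = lc-bv (<⇒≤ (s≤s j<k))
lc-openTmAt⁻¹ k x (ƛ M)   (lc-ƛ l)    = lc-ƛ (lc-openTmAt⁻¹ (suc k) x M l)
lc-openTmAt⁻¹ k x (M · N) (lc-· l l') = lc-· (lc-openTmAt⁻¹ k x M l) (lc-openTmAt⁻¹ k x N l')

lc-substTm : ∀ {k x N M} → LCTm k M → LCTm 0 N → LCTm k (substTm x N M)
lc-substTm {x = x} {M = fv y} lc-fv lcN with y ≡ᵇ x
... | true  = lc-weaken z≤n lcN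
... | false = lc-fv
lc-substTm (lc-bv p)   lcN = lc-bv p
lc-substTm (lc-ƛ l)    lcN = lc-ƛ (lc-substTm l lcN)
lc-substTm (lc-· l l') lcN = lc-· (lc-substTm l lcN) (lc-substTm l' lcN)

openTmAt-lc : ∀ {k k' y N} → k ≤ k' → LCTm k N → openTmAt k' y N ≡ N
openTmAt-lc k≤k' lc-fv = refl
openTmAt-lc k≤k' (lc-bv j<k) rewrite ≡ᵇ-≢ (<⇒≢ (≤-trans j<k k≤k')) = refl
openTmAt-lc k≤k' (lc-ƛ l)    = cong ƛ_ (openTmAt-lc (s≤s k≤k') l)
openTmAt-lc k≤k' (lc-· l l') = cong₂ _·_ (openTmAt-lc k≤k' l) (openTmAt-lc k≤k' l')

substTm-openTmAt : ∀ {x y N} k M → y ≢ x → LCTm 0 N →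
  substTm x N (openTmAt k y M) ≡ openTmAt k y (substTm x N M)
substTm-openTmAt {x} k (fv z) y≢x lcN with z ≡ᵇ x
... | true  = sym (openTmAt-lc z≤n lcN)
... | false = refl
substTm-openTmAt k (bv j) y≢x lcN with j ≡ᵇ k
... | true  rewrite ≡ᵇ-≢ y≢x = refl
... | false = refl
substTm-openTmAt k (ƛ M) y≢x lcN = cong ƛ_ (substTm-openTmAt (suc k) M y≢x lcN)
substTm-openTmAt k (M · M') y≢x lcN =
  cong₂ _·_ (substTm-openTmAt k M y≢x lcN) (substTm-openTmAt k M' y≢x lcN)

_⊆_ : Ctx → Ctx → Set
Γ ⊆ Δ = ∀ z {C} → lookupCtx Γ z ≡ just C → lookupCtx Δ z ≡ just C

⊆-∪ˡ : ∀ Γ Δ → Γ ⊆ (Γ ∪ Δ)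
⊆-∪ˡ []            Δ z ()
⊆-∪ˡ ((y , A) ∷ Γ) Δ z e with y ≡ᵇ z
... | true  = e
... | false = ⊆-∪ˡ Γ Δ z e

lookup-∪-miss : ∀ Γ Δ {z} → lookupCtx Γ z ≡ nothing → lookupCtx (Γ ∪ Δ) z ≡ lookupCtx Δ z
lookup-∪-miss []            Δ e = refl
lookup-∪-miss ((y , A) ∷ Γ) Δ {z} e with y ≡ᵇ z
lookup-∪-miss ((y , A) ∷ Γ) Δ () | true
lookup-∪-miss ((y , A) ∷ Γ) Δ e  | false = lookup-∪-miss Γ Δ e

⊆-∪ʳ : ∀ Γ Δ → Compatible Γ Δ → Δ ⊆ (Γ ∪ Δ)
⊆-∪ʳ Γ Δ compat z e with lookupCtx Γ z in eΓ
... | just C  = trans (⊆-∪ˡ Γ Δ z eΓ) (cong just (compat z eΓ e))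
... | nothing = trans (lookup-∪-miss Γ Δ eΓ) e

lookup-∪ : ∀ Γ Δ {z C} → lookupCtx (Γ ∪ Δ) z ≡ just C →
  lookupCtx Γ z ≡ just C ⊎ (lookupCtx Γ z ≡ nothing × lookupCtx Δ z ≡ just C)
lookup-∪ []            Δ e = inj₂ (refl , e)
lookup-∪ ((y , A) ∷ Γ) Δ {z} e with y ≡ᵇ z
... | true  = inj₁ e
... | false = lookup-∪ Γ Δ e

lookup-single : ∀ {x A z C} → lookupCtx ⟦ x ∶ A ⟧ z ≡ just C → x ≡ z × A ≡ C
lookup-single {x} {z = z} e with x ≡ᵇ z | ≡ᵇ-reflects x z
lookup-single refl | true  | ofʸ x≡z = x≡z , refl
lookup-single ()   | false | _

lookup-single-self : ∀ x A → lookupCtx ⟦ x ∶ A ⟧ x ≡ just A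
lookup-single-self x A rewrite ≡ᵇ-refl x = refl

lookup-extend-self : ∀ Γ {x A E} → Compatible Γ ⟦ x ∶ A ⟧ →
  lookupCtx (Γ ∪ ⟦ x ∶ A ⟧) x ≡ just E → E ≡ A
lookup-extend-self Γ {x} {A} compat e with lookup-∪ Γ ⟦ x ∶ A ⟧ e
... | inj₁ eΓ       = compat x eΓ (lookup-single-self x A)
... | inj₂ (_ , e₁) = sym (proj₂ (lookup-single {x} {A} {x} e₁))

lookup-extend-other : ∀ Γ {x A z C} → z ≢ x →
  lookupCtx (Γ ∪ ⟦ x ∶ A ⟧) z ≡ just C → lookupCtx Γ z ≡ just C
lookup-extend-other Γ {x} {A} z≢x e with lookup-∪ Γ ⟦ x ∶ A ⟧ e
... | inj₁ eΓ       = eΓ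
... | inj₂ (_ , e₁) = ⊥-elim (z≢x (sym (proj₁ (lookup-single {x} {A} e₁))))

compatible-self : ∀ Δ → Compatible Δ Δ
compatible-self Δ x e₁ e₂ = just-injective (trans (sym e₁) e₂)

-- Δ ∪ Δ is Δ, so the application rule can use one context for both premises.
≋-∪-self : ∀ Δ → Δ ≋ (Δ ∪ Δ)
≋-∪-self Δ z with lookupCtx Δ z in e
... | just C  = sym (⊆-∪ˡ Δ Δ z e)
... | nothing = sym (trans (lookup-∪-miss Δ Δ e) e)

compatible-unbound : ∀ Δ y {A} → lookupCtx Δ y ≡ nothing → Compatible Δ ⟦ y ∶ A ⟧
compatible-unbound Δ y {A} Δy≡nothing z e₁ e₂ with lookup-single {y} {A} e₂
... | refl , _ with trans (sym Δy≡nothing) e₁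
...   | ()

lookup-• : ∀ Γ z → lookupCtx (•ctx Γ) z ≡ Maybe.map •_ (lookupCtx Γ z)
lookup-• []            z = refl
lookup-• ((y , A) ∷ Γ) z with y ≡ᵇ z
... | true  = refl
... | false = lookup-• Γ z

lookup-•-just : ∀ Γ {z A} → lookupCtx Γ z ≡ just A → lookupCtx (•ctx Γ) z ≡ just (• A)
lookup-•-just Γ {z} e rewrite lookup-• Γ z | e = refl

lookup-•-inv : ∀ Γ {z C} → lookupCtx (•ctx Γ) z ≡ just C → ∃ λ A → lookupCtx Γ z ≡ just A × C ≡ • A
lookup-•-inv Γ {z} e rewrite lookup-• Γ z with lookupCtx Γ z
lookup-•-inv Γ refl | just A = A , refl , refl

compatible-• : ∀ Γ Δ → Compatible Γ Δ → Compatible (•ctx Γ) (•ctx Δ)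
compatible-• Γ Δ compat x e₁ e₂ with lookup-•-inv Γ e₁ | lookup-•-inv Δ e₂
... | A , eA , refl | B , eB , refl = cong •_ (compat x eA eB)

≋-• : ∀ Γ Γ₁ Γ₂ → Γ ≋ (Γ₁ ∪ Γ₂) → •ctx Γ ≋ (•ctx Γ₁ ∪ •ctx Γ₂)
≋-• Γ Γ₁ Γ₂ Γ≋ z = begin
  lookupCtx (•ctx Γ) z                  ≡⟨ lookup-• Γ z ⟩
  Maybe.map •_ (lookupCtx Γ z)          ≡⟨ cong (Maybe.map •_) (Γ≋ z) ⟩
  Maybe.map •_ (lookupCtx (Γ₁ ∪ Γ₂) z)  ≡⟨ sym (lookup-• (Γ₁ ∪ Γ₂) z) ⟩
  lookupCtx (•ctx (Γ₁ ∪ Γ₂)) z          ≡⟨ cong (λ Δ → lookupCtx Δ z) (map-++ (map₂ •_) Γ₁ Γ₂) ⟩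
  lookupCtx (•ctx Γ₁ ∪ •ctx Γ₂) z       ∎
  where open ≡-Reasoning

nameBoundTm : Tm → ℕ
nameBoundTm (fv y)  = y
nameBoundTm (bv j)  = 0
nameBoundTm (ƛ M)   = nameBoundTm M
nameBoundTm (M · N) = nameBoundTm M + nameBoundTm N

free-≤-nameBoundTm : ∀ {z} M → FreeInTm z M → z ≤ nameBoundTm M
free-≤-nameBoundTm (fv y)  fv-var    = ≤-refl
free-≤-nameBoundTm (ƛ M)   (fv-ƛ f)  = free-≤-nameBoundTm M f
free-≤-nameBoundTm (M · N) (fv-·ˡ f) = ≤-trans (free-≤-nameBoundTm M f) (m≤m+n _ _)
free-≤-nameBoundTm (M · N) (fv-·ʳ f) = ≤-trans (free-≤-nameBoundTm N f) (m≤n+m _ _)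

nameBoundCtx : Ctx → ℕ
nameBoundCtx []            = 0
nameBoundCtx ((y , A) ∷ Γ) = y + nameBoundCtx Γ

unbound-> : ∀ {z} Γ → nameBoundCtx Γ < z → lookupCtx Γ z ≡ nothing
unbound-> []            _ = refl
unbound-> ((y , A) ∷ Γ) max<z
  rewrite ≡ᵇ-≢ (<⇒≢ (≤-<-trans (m≤m+n y (nameBoundCtx Γ)) max<z))
  = unbound-> Γ (≤-<-trans (m≤n+m _ y) max<z)

fresh : ∀ M Γ → ∃ λ y → ¬ FreeInTm y M × lookupCtx Γ y ≡ nothing
fresh M Γ = y , y∉M , unbound-> Γ (s≤s (m≤n+m _ _))
  where
    y = suc (nameBoundTm M + nameBoundCtx Γ)
    y∉M : ¬ FreeInTm y M
    y∉M f = <⇒≢ (≤-<-trans (free-≤-nameBoundTm M f) (s≤s (m≤m+n _ _))) refl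

marked-< : ∀ {bs i} → Marked bs i → i < length bs
marked-< here      = s≤s z≤n
marked-< (there m) = s≤s (marked-< m)

topChain-openTyAt : ∀ {bs k U} B → length bs ≤ k →
  TopChain bs (tailTy B) → TopChain bs (tailTy (openTyAt k U B))
topChain-openTyAt (bvT j) len≤k (tc-var m) rewrite ≡ᵇ-≢ (<⇒≢ (≤-trans (marked-< m) len≤k)) = tc-var m
topChain-openTyAt (A ⇒ B) len≤k t = topChain-openTyAt B len≤k t
topChain-openTyAt {bs} (• A) len≤k (tc-• t) =
  tc-• (topChain-openTyAt A (subst (_≤ _) (sym (length-map _ bs)) len≤k) t)
topChain-openTyAt (μ A) len≤k (tc-μ t) = tc-μ (topChain-openTyAt A (s≤s len≤k) t)

wf-weaken : ∀ {k k' A} → k ≤ k' → WF k A → WF k' A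
wf-weaken k≤k' wf-fvar     = wf-fvar
wf-weaken k≤k' (wf-bvar p) = wf-bvar (≤-trans p k≤k')
wf-weaken k≤k' (wf-⇒ a b)  = wf-⇒ (wf-weaken k≤k' a) (wf-weaken k≤k' b)
wf-weaken k≤k' (wf-• a)    = wf-• (wf-weaken k≤k' a)
wf-weaken k≤k' (wf-μ a p)  = wf-μ (wf-weaken (s≤s k≤k') a) p

proper-wf : ∀ {k j U} → WF k U → k ≤ j → Proper j U
proper-wf wf-fvar     k≤j = pr-fvar
proper-wf (wf-bvar p) k≤j = pr-bvar (<⇒≢ (≤-trans p k≤j))
proper-wf (wf-⇒ a b)  k≤j = pr-⇒ (proper-wf a k≤j) (proper-wf b k≤j)
proper-wf (wf-• a)    k≤j = pr-•
proper-wf (wf-μ a p)  k≤j = pr-μ (proper-wf a (s≤s k≤j))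

proper-openTyAt : ∀ {j k U A} → IsType U → Proper j A → Proper j (openTyAt k U A)
proper-openTyAt u pr-fvar = pr-fvar
proper-openTyAt {k = k} u (pr-bvar {j = i} i≢j) with i ≡ᵇ k
... | true  = proper-wf u z≤n
... | false = pr-bvar i≢j
proper-openTyAt u pr-•               = pr-•
proper-openTyAt u (pr-⇒ a b)         = pr-⇒ (proper-openTyAt u a) (proper-openTyAt u b)
proper-openTyAt u (pr-⇒⊤ {B = B} t)  = pr-⇒⊤ (topChain-openTyAt B z≤n t)
proper-openTyAt u (pr-μ a)           = pr-μ (proper-openTyAt u a)
proper-openTyAt u (pr-μ⊤ {A = A} t)  = pr-μ⊤ (topChain-openTyAt (μ A) z≤n t)

wf-openTyAt : ∀ {k U A} → WF (suc k) A → IsType U → WF k (openTyAt k U A)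
wf-openTyAt wf-fvar u = wf-fvar
wf-openTyAt {k} (wf-bvar {j = j} j<1+k) u with j ≡ᵇ k | ≡ᵇ-reflects j k
... | true  | _        = wf-weaken z≤n u
... | false | ofⁿ j≢k = wf-bvar (≤∧≢⇒< (≤-pred j<1+k) j≢k)
wf-openTyAt (wf-⇒ a b) u = wf-⇒ (wf-openTyAt a u) (wf-openTyAt b u)
wf-openTyAt (wf-• a)   u = wf-• (wf-openTyAt a u)
wf-openTyAt (wf-μ a p) u = wf-μ (wf-openTyAt a u) (proper-openTyAt u p)

isType-Top : IsType Top
isType-Top = wf-μ (wf-• (wf-bvar (s≤s z≤n))) pr-•

≃-isType : ∀ {A B} → A ≃ B → IsType A × IsType B
≃-isType (≃-refl a)    = a , a
≃-isType (≃-sym e)     = proj₂ (≃-isType e) , proj₁ (≃-isType e)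
≃-isType (≃-trans e f) = proj₁ (≃-isType e) , proj₂ (≃-isType f)
≃-isType (≃-• e)       = wf-• (proj₁ (≃-isType e)) , wf-• (proj₂ (≃-isType e))
≃-isType (≃-⇒ e f)     =
  wf-⇒ (proj₁ (≃-isType e)) (proj₁ (≃-isType f)) , wf-⇒ (proj₂ (≃-isType e)) (proj₂ (≃-isType f))
≃-isType (≃-⇒⊤ a)                = wf-⇒ a isType-Top , isType-Top
≃-isType (≃-unfold (wf-μ a p))   = wf-μ a p , wf-openTyAt a (wf-μ a p)
≃-isType (≃-fold a c e)          = a , c
≃-isType (≃-•⇒ a b)              = wf-• (wf-⇒ a b) , wf-⇒ (wf-• a) (wf-• b)

⪯-isType : ∀ {γ A B} → γ ⊢ A ⪯ B → IsType A × IsType B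
⪯-isType (⪯-hyp _)       = wf-fvar , wf-fvar
⪯-isType (⪯-top a)       = a , isType-Top
⪯-isType (⪯-eq e)        = ≃-isType e
⪯-isType (⪯-trans s t _) = proj₁ (⪯-isType s) , proj₂ (⪯-isType t)
⪯-isType (⪯-• s)         = wf-• (proj₁ (⪯-isType s)) , wf-• (proj₂ (⪯-isType s))
⪯-isType (⪯-⇒ s t _)     =
  wf-⇒ (proj₂ (⪯-isType s)) (proj₁ (⪯-isType t)) , wf-⇒ (proj₁ (⪯-isType s)) (proj₂ (⪯-isType t))
⪯-isType (⪯-μ _ _ _ _ _ _ _ _ _ a b _) = a , b
⪯-isType (⪯-next a)      = a , wf-• a

valid-• : ∀ Γ → ValidCtx Γ → ValidCtx (•ctx Γ)
valid-• Γ valid x e with lookup-•-inv Γ e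
... | A , eA , refl = wf-• (valid x eA)

valid-∪ : ∀ Γ Δ → ValidCtx Γ → ValidCtx Δ → ValidCtx (Γ ∪ Δ)
valid-∪ Γ Δ validΓ validΔ x e with lookup-∪ Γ Δ e
... | inj₁ eΓ       = validΓ x eΓ
... | inj₂ (_ , eΔ) = validΔ x eΔ

valid-extend : ∀ Γ {x A} → ValidCtx Γ → IsType A → ValidCtx (Γ ∪ ⟦ x ∶ A ⟧)
valid-extend Γ {x} {A} valid a = valid-∪ Γ ⟦ x ∶ A ⟧ valid single
  where
    single : ValidCtx ⟦ x ∶ A ⟧
    single z e with lookup-single {x} {A} e
    ... | _ , refl = a

valid-⊆ : ∀ Γ Δ → Γ ⊆ Δ → ValidCtx Δ → ValidCtx Γ
valid-⊆ Γ Δ Γ⊆Δ valid z = valid z ∘ Γ⊆Δ z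

∪-⊆ˡ : ∀ Γ Γ₁ Γ₂ → Γ ≋ (Γ₁ ∪ Γ₂) → Γ₁ ⊆ Γ
∪-⊆ˡ Γ Γ₁ Γ₂ Γ≋ z e = trans (Γ≋ z) (⊆-∪ˡ Γ₁ Γ₂ z e)

∪-⊆ʳ : ∀ Γ Γ₁ Γ₂ → Compatible Γ₁ Γ₂ → Γ ≋ (Γ₁ ∪ Γ₂) → Γ₂ ⊆ Γ
∪-⊆ʳ Γ Γ₁ Γ₂ compat Γ≋ z e = trans (Γ≋ z) (⊆-∪ʳ Γ₁ Γ₂ compat z e)

typed-isType : ∀ Γ {M A} → ValidCtx Γ → Γ ⊢ M ∶ A → IsType A
typed-isType Γ valid (ty-var e) = valid _ e
typed-isType Γ valid (ty-• d) with typed-isType (•ctx Γ) (valid-• Γ valid) d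
... | wf-• a = a
typed-isType Γ valid (ty-top _)   = isType-Top
typed-isType Γ valid (ty-sub d s) = proj₂ (⪯-isType s)
typed-isType Γ valid (ty-ƛ x _ a _ d) = wf-⇒ a (typed-isType _ (valid-extend Γ valid a) d)
typed-isType Γ valid (ty-· {Γ₁ = Γ₁} {Γ₂} d₁ _ _ Γ≋)
  with typed-isType Γ₁ (valid-⊆ Γ₁ Γ (∪-⊆ˡ Γ Γ₁ Γ₂ Γ≋) valid) d₁
... | wf-⇒ _ b = b

typed-lc : ∀ {Γ M A} → Γ ⊢ M ∶ A → LCTm 0 M
typed-lc (ty-var _)             = lc-fv
typed-lc (ty-• d)               = typed-lc d
typed-lc (ty-top l)             = l
typed-lc (ty-sub d _)           = typed-lc d
typed-lc (ty-ƛ {M = M} x _ _ _ d) = lc-ƛ (lc-openTmAt⁻¹ 0 x M (typed-lc d))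
typed-lc (ty-· d d' _ _)        = lc-· (typed-lc d) (typed-lc d')

record RenamesInto (P : ℕ → Set) (σ : ℕ → ℕ) (M : Tm) (Γ Δ : Ctx) : Set where
  constructor renamesInto
  field
    transport : ∀ z {C} → P z → FreeInTm z M → lookupCtx Γ z ≡ just C → lookupCtx Δ (σ z) ≡ just C
open RenamesInto

renamesInto-restrict : ∀ {P σ M M' Γ Γ' Δ} → Γ' ⊆ Γ → (∀ {z} → FreeInTm z M' → FreeInTm z M) →
  RenamesInto P σ M Γ Δ → RenamesInto P σ M' Γ' Δ
renamesInto-restrict Γ'⊆Γ free ρ = renamesInto λ z p f e → transport ρ z p (free f) (Γ'⊆Γ z e)

renamesInto-• : ∀ {P σ M Γ Δ} → RenamesInto P σ M Γ Δ → RenamesInto P σ M (•ctx Γ) (•ctx Δ)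
renamesInto-• {P} {σ} {M} {Γ} {Δ} ρ = renamesInto transport•
  where
    transport• : ∀ z {C} → P z → FreeInTm z M →
      lookupCtx (•ctx Γ) z ≡ just C → lookupCtx (•ctx Δ) (σ z) ≡ just C
    transport• z p f e with lookup-•-inv Γ e
    ... | A , eA , refl = lookup-•-just Δ (transport ρ z p f eA)

renamesInto-binder : ∀ {P σ M Γ Δ a b A} → InjectiveRenaming σ →
  ¬ FreeInTm b (renTm σ M) → lookupCtx Δ b ≡ nothing → Compatible Γ ⟦ a ∶ A ⟧ →
  RenamesInto P σ (ƛ M) Γ Δ →
  RenamesInto P (rebind σ a b) (openTm M a) (Γ ∪ ⟦ a ∶ A ⟧) (Δ ∪ ⟦ b ∶ A ⟧)
renamesInto-binder {P} {σ} {M} {Γ} {Δ} {a} {b} {A} σ-inj b∉σM b∉Δ compat ρ = renamesInto moved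
  where
    open ≡-Reasoning
    Δ' : Ctx
    Δ' = Δ ∪ ⟦ b ∶ A ⟧
    moved : ∀ z {C} → P z → FreeInTm z (openTm M a) →
      lookupCtx (Γ ∪ ⟦ a ∶ A ⟧) z ≡ just C → lookupCtx Δ' (rebind σ a b z) ≡ just C
    moved z {C} p f e with z ≟ a
    ... | yes refl = begin
      lookupCtx Δ' (transpose (σ z) b (σ z)) ≡⟨ cong (lookupCtx Δ') (transpose-left (σ z) b) ⟩
      lookupCtx Δ' b                         ≡⟨ lookup-∪-miss Δ ⟦ b ∶ A ⟧ b∉Δ ⟩
      lookupCtx ⟦ b ∶ A ⟧ b                  ≡⟨ lookup-single-self b A ⟩
      just A                                 ≡⟨ cong just (sym (lookup-extend-self Γ compat e)) ⟩
      just C                                 ∎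
    ... | no z≢a with free-openTmAt 0 a M f
    ...   | inj₁ z≡a = ⊥-elim (z≢a z≡a)
    ...   | inj₂ z∈M = begin
      lookupCtx Δ' (transpose (σ a) b (σ z)) ≡⟨ cong (lookupCtx Δ') (transpose-other (z≢a ∘ σ-inj) σz≢b) ⟩
      lookupCtx Δ' (σ z)                     ≡⟨ ⊆-∪ˡ Δ ⟦ b ∶ A ⟧ (σ z) Δσz ⟩
      just C                                 ∎
      where
        σz≢b : σ z ≢ b
        σz≢b σz≡b = b∉σM (subst (λ w → FreeInTm w (renTm σ M)) σz≡b (free-renTm M z∈M))
        Δσz : lookupCtx Δ (σ z) ≡ just C
        Δσz = transport ρ z p (fv-ƛ z∈M) (lookup-extend-other Γ z≢a e)

renTm-rebind-open : ∀ {σ a b} M → InjectiveRenaming σ → ¬ FreeInTm a M → ¬ FreeInTm b (renTm σ M) →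
  renTm (rebind σ a b) (openTm M a) ≡ openTm (renTm σ M) b
renTm-rebind-open {σ} {a} {b} M σ-inj a∉M b∉σM = begin
  renTm (rebind σ a b) (openTm M a)                   ≡⟨ renTm-openTmAt (rebind σ a b) 0 a M ⟩
  openTm (renTm (rebind σ a b) M) (rebind σ a b a)    ≡⟨ cong (openTm (renTm (rebind σ a b) M)) (transpose-left (σ a) b) ⟩
  openTm (renTm (rebind σ a b) M) b                   ≡⟨ cong (λ t → openTm t b) (sym (renTm-∘ (transpose (σ a) b) σ M)) ⟩
  openTm (renTm (transpose (σ a) b) (renTm σ M)) b    ≡⟨ cong (λ t → openTm t b) (renTm-fix _ (renTm σ M) fixed) ⟩
  openTm (renTm σ M) b                                ∎
  where
    open ≡-Reasoning
    fixed : ∀ z → FreeInTm z (renTm σ M) → transpose (σ a) b z ≡ z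
    fixed z f = transpose-other (λ { refl → a∉M (free-renTm⁻¹ σ-inj M f) }) (λ { refl → b∉σM f })

substTm-rebind-open : ∀ {σ x y y' N} M → InjectiveRenaming σ → x ≢ y → ¬ FreeInTm y M →
  ¬ FreeInTm y' (renTm σ M) → y' ≢ σ x → LCTm 0 N →
  substTm (rebind σ y y' x) N (renTm (rebind σ y y') (openTm M y)) ≡
  openTm (substTm (σ x) N (renTm σ M)) y'
substTm-rebind-open {σ} {x} {y} {y'} {N} M σ-inj x≢y y∉M y'∉σM y'≢σx lcN = begin
  substTm (rebind σ y y' x) N (renTm (rebind σ y y') (openTm M y))
    ≡⟨ cong₂ (λ u t → substTm u N t) (transpose-other (x≢y ∘ σ-inj) (y'≢σx ∘ sym))
                                     (renTm-rebind-open M σ-inj y∉M y'∉σM) ⟩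
  substTm (σ x) N (openTm (renTm σ M) y')
    ≡⟨ substTm-openTmAt 0 (renTm σ M) y'≢σx lcN ⟩
  openTm (substTm (σ x) N (renTm σ M)) y' ∎
  where open ≡-Reasoning

rename : ∀ {Γ Δ M A} σ → InjectiveRenaming σ → RenamesInto (λ _ → Unit) σ M Γ Δ →
  Γ ⊢ M ∶ A → Δ ⊢ renTm σ M ∶ A
rename σ σ-inj ρ (ty-var e)   = ty-var (transport ρ _ tt fv-var e)
rename σ σ-inj ρ (ty-• d)     = ty-• (rename σ σ-inj (renamesInto-• ρ) d)
rename σ σ-inj ρ (ty-top l)   = ty-top (lc-renTm l)
rename σ σ-inj ρ (ty-sub d s) = ty-sub (rename σ σ-inj ρ d) s
rename {Δ = Δ} σ σ-inj ρ (ty-ƛ {M = M} {A} {B} x x∉M a compat d) with fresh (renTm σ M) Δ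
... | y , y∉σM , y∉Δ = ty-ƛ y y∉σM a (compatible-unbound Δ y y∉Δ) body
  where
    body : (Δ ∪ ⟦ y ∶ A ⟧) ⊢ openTm (renTm σ M) y ∶ B
    body = subst (λ t → (Δ ∪ ⟦ y ∶ A ⟧) ⊢ t ∶ B) (renTm-rebind-open M σ-inj x∉M y∉σM)
             (rename (rebind σ x y) (rebind-injective x y σ-inj)
                     (renamesInto-binder σ-inj y∉σM y∉Δ compat ρ) d)
rename {Γ} {Δ} σ σ-inj ρ (ty-· {Γ₁ = Γ₁} {Γ₂} d₁ d₂ compat Γ≋) =
  ty-· {Γ₁ = Δ} {Γ₂ = Δ}
       (rename {Γ₁} σ σ-inj (renamesInto-restrict (∪-⊆ˡ Γ Γ₁ Γ₂ Γ≋) fv-·ˡ ρ) d₁)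
       (rename {Γ₂} σ σ-inj (renamesInto-restrict (∪-⊆ʳ Γ Γ₁ Γ₂ compat Γ≋) fv-·ʳ ρ) d₂)
       (compatible-self Δ) (≋-∪-self Δ)

weaken : ∀ {Γ Δ M A} → Γ ⊆ Δ → Γ ⊢ M ∶ A → Δ ⊢ M ∶ A
weaken {Δ = Δ} {M} {A} Γ⊆Δ d =
  subst (λ t → Δ ⊢ t ∶ A) (renTm-id M) (rename id id (renamesInto λ z _ _ → Γ⊆Δ z) d)

-- Γ ⊢ M : A gives •Γ ⊢ M : •A.  The interesting cases are λ and application,
-- where •(A → B) ≃ •A → •B moves the • through the arrow.
delay : ∀ Γ {M A} → ValidCtx Γ → Γ ⊢ M ∶ A → •ctx Γ ⊢ M ∶ • A
delay Γ valid (ty-var e)   = ty-var (lookup-•-just Γ e)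
delay Γ valid (ty-• d)     = ty-• (delay (•ctx Γ) (valid-• Γ valid) d)
delay Γ valid (ty-top l)   = ty-sub (ty-top l) (⪯-next isType-Top)
delay Γ valid (ty-sub d s) = ty-sub (delay Γ valid d) (⪯-• s)
delay Γ valid (ty-ƛ {M = M} {A} {B} x x∉M a compat d) =
  ty-sub (ty-ƛ x x∉M (wf-• a) (compatible-• Γ ⟦ x ∶ A ⟧ compat) body) (⪯-eq (≃-sym (≃-•⇒ a b)))
  where
    valid' : ValidCtx (Γ ∪ ⟦ x ∶ A ⟧)
    valid' = valid-extend Γ valid a
    b : IsType B
    b = typed-isType _ valid' d
    body : (•ctx Γ ∪ ⟦ x ∶ • A ⟧) ⊢ openTm M x ∶ • B
    body = subst (λ Δ → Δ ⊢ openTm M x ∶ • B) (map-++ (map₂ •_) Γ ⟦ x ∶ A ⟧) (delay _ valid' d)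
delay Γ valid (ty-· {Γ₁ = Γ₁} {Γ₂} {A = A} {B} d₁ d₂ compat Γ≋) =
  ty-· (ty-sub (delay Γ₁ valid₁ d₁) (⪯-eq (≃-•⇒ (proj₁ arrow-parts) (proj₂ arrow-parts))))
       (delay Γ₂ valid₂ d₂) (compatible-• Γ₁ Γ₂ compat) (≋-• Γ Γ₁ Γ₂ Γ≋)
  where
    valid₁ : ValidCtx Γ₁
    valid₁ = valid-⊆ Γ₁ Γ (∪-⊆ˡ Γ Γ₁ Γ₂ Γ≋) valid
    valid₂ : ValidCtx Γ₂
    valid₂ = valid-⊆ Γ₂ Γ (∪-⊆ʳ Γ Γ₁ Γ₂ compat Γ≋) valid
    arrow-parts : IsType A × IsType B
    arrow-parts with typed-isType Γ₁ valid₁ d₁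
    ... | wf-⇒ a b = a , b

free-ƛ⁻¹ : ∀ {z M} → FreeInTm z (ƛ M) → FreeInTm z M
free-ƛ⁻¹ (fv-ƛ f) = f

subst-rename : ∀ {Ξ M B} Θ x A N σ → InjectiveRenaming σ →
  (∀ {E} → lookupCtx Ξ x ≡ just E → E ≡ A) → RenamesInto (_≢ x) σ M Ξ Θ →
  ValidCtx Θ → Θ ⊢ N ∶ A → Ξ ⊢ M ∶ B → Θ ⊢ substTm (σ x) N (renTm σ M) ∶ B
subst-rename Θ x A N σ σ-inj Ξx ρ valid dN (ty-var {x = z} e) with z ≟ x
... | yes refl rewrite ≡ᵇ-refl (σ z)      = subst (Θ ⊢ N ∶_) (sym (Ξx e)) dN
... | no z≢x   rewrite ≡ᵇ-≢ (z≢x ∘ σ-inj) = ty-var (transport ρ z z≢x fv-var e)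
subst-rename {Ξ} Θ x A N σ σ-inj Ξx ρ valid dN (ty-• d) =
  ty-• (subst-rename (•ctx Θ) x (• A) N σ σ-inj •Ξx (renamesInto-• ρ)
                     (valid-• Θ valid) (delay Θ valid dN) d)
  where
    •Ξx : ∀ {E} → lookupCtx (•ctx Ξ) x ≡ just E → E ≡ • A
    •Ξx e with lookup-•-inv Ξ e
    ... | E , eE , refl = cong •_ (Ξx eE)
subst-rename Θ x A N σ σ-inj Ξx ρ valid dN (ty-top l) =
  ty-top (lc-substTm (lc-renTm l) (typed-lc dN))
subst-rename Θ x A N σ σ-inj Ξx ρ valid dN (ty-sub d s) =
  ty-sub (subst-rename Θ x A N σ σ-inj Ξx ρ valid dN d) s
subst-rename {Ξ} Θ x A N σ σ-inj Ξx ρ valid dN (ty-· {Γ₁ = Γ₁} {Γ₂} d₁ d₂ compat Ξ≋) =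
  ty-· {Γ₁ = Θ} {Γ₂ = Θ}
       (subst-rename Θ x A N σ σ-inj (λ e → Ξx (Γ₁⊆Ξ x e)) (renamesInto-restrict Γ₁⊆Ξ fv-·ˡ ρ) valid dN d₁)
       (subst-rename Θ x A N σ σ-inj (λ e → Ξx (Γ₂⊆Ξ x e)) (renamesInto-restrict Γ₂⊆Ξ fv-·ʳ ρ) valid dN d₂)
       (compatible-self Θ) (≋-∪-self Θ)
  where
    Γ₁⊆Ξ : Γ₁ ⊆ Ξ
    Γ₁⊆Ξ = ∪-⊆ˡ Ξ Γ₁ Γ₂ Ξ≋
    Γ₂⊆Ξ : Γ₂ ⊆ Ξ
    Γ₂⊆Ξ = ∪-⊆ʳ Ξ Γ₁ Γ₂ compat Ξ≋
-- When the binder is named x itself, x is not free and the substitution is void.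
subst-rename {Ξ} Θ x A N σ σ-inj Ξx ρ valid dN (ty-ƛ {M = M} {C} {D} y y∉M c compat d) with x ≟ y
... | yes refl =
  subst (λ t → Θ ⊢ t ∶ C ⇒ D) (sym (substTm-nonfree (renTm σ (ƛ M)) σx∉σƛM))
        (rename σ σ-inj ρ' (ty-ƛ y y∉M c compat d))
  where
    σx∉σƛM : ¬ FreeInTm (σ x) (renTm σ (ƛ M))
    σx∉σƛM = y∉M ∘ free-ƛ⁻¹ ∘ free-renTm⁻¹ σ-inj (ƛ M)
    ρ' : RenamesInto (λ _ → Unit) σ (ƛ M) Ξ Θ
    ρ' = renamesInto λ z _ f → transport ρ z (λ { refl → y∉M (free-ƛ⁻¹ f) }) f
-- Otherwise rename the binder to y', fresh for σM, N, σx and Θ, and use induction.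
... | no x≢y with fresh (renTm σ M · N · fv (σ x)) Θ
...   | y' , y'∉ , y'∉Θ = ty-ƛ y' y'∉MN c (compatible-unbound Θ y' y'∉Θ) body
  where
    P : Tm
    P = renTm σ M
    Θ' : Ctx
    Θ' = Θ ∪ ⟦ y' ∶ C ⟧
    y'∉P : ¬ FreeInTm y' P
    y'∉P = y'∉ ∘ fv-·ˡ ∘ fv-·ˡ
    y'≢σx : y' ≢ σ x
    y'≢σx refl = y'∉ (fv-·ʳ fv-var)
    y'∉MN : ¬ FreeInTm y' (substTm (σ x) N P)
    y'∉MN f = Sum.[ y'∉P , y'∉ ∘ fv-·ˡ ∘ fv-·ʳ ]′ (free-substTm P f)
    IH : Θ' ⊢ substTm (rebind σ y y' x) N (renTm (rebind σ y y') (openTm M y)) ∶ D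
    IH = subst-rename Θ' x A N (rebind σ y y') (rebind-injective y y' σ-inj)
           (λ e → Ξx (lookup-extend-other Ξ x≢y e))
           (renamesInto-binder σ-inj y'∉P y'∉Θ compat ρ)
           (valid-extend Θ valid c) (weaken (⊆-∪ˡ Θ ⟦ y' ∶ C ⟧) dN) d
    body : Θ' ⊢ openTm (substTm (σ x) N P) y' ∶ D
    body = subst (λ t → Θ' ⊢ t ∶ D) (substTm-rebind-open M σ-inj x≢y y∉M y'∉P y'≢σx (typed-lc dN)) IH

substitution : ∀ Γ Θ {x A M N B} → Γ ⊆ Θ → ValidCtx Θ → Compatible Γ ⟦ x ∶ A ⟧ →
  (Γ ∪ ⟦ x ∶ A ⟧) ⊢ M ∶ B → Θ ⊢ N ∶ A → Θ ⊢ substTm x N M ∶ B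
substitution Γ Θ {x} {A} {M} {N} {B} Γ⊆Θ valid compat d dN =
  subst (λ t → Θ ⊢ substTm x N t ∶ B) (renTm-id M)
        (subst-rename Θ x A N id id (lookup-extend-self Γ compat) ρ valid dN d)
  where
    ρ : RenamesInto (_≢ x) id M (Γ ∪ ⟦ x ∶ A ⟧) Θ
    ρ = renamesInto λ z z≢x _ e → Γ⊆Θ z (lookup-extend-other Γ z≢x e)

proposition7p4 :
    (∀ (Γ₁ Γ₂ : Ctx) (M : Tm) (A : Ty) →
       ValidCtx Γ₁ → ValidCtx Γ₂ → Compatible (•ctx Γ₁) Γ₂ →
       Γ₁ ⊢ M ∶ A →
       (•ctx Γ₁ ∪ Γ₂) ⊢ M ∶ • A)
    ×
    (∀ (Γ₁ Γ₂ : Ctx) (x : ℕ) (M N : Tm) (A B : Ty) →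
       ValidCtx Γ₁ → ValidCtx Γ₂ → Compatible Γ₁ Γ₂ →
       IsType A → Compatible Γ₁ ⟦ x ∶ A ⟧ →
       (Γ₁ ∪ ⟦ x ∶ A ⟧) ⊢ M ∶ B →
       Γ₂ ⊢ N ∶ A →
       (Γ₁ ∪ Γ₂) ⊢ substTm x N M ∶ B)
proposition7p4 = delay-into-union , substitute-into-union
  where
    delay-into-union : ∀ Γ₁ Γ₂ M A → ValidCtx Γ₁ → ValidCtx Γ₂ → Compatible (•ctx Γ₁) Γ₂ →
      Γ₁ ⊢ M ∶ A → (•ctx Γ₁ ∪ Γ₂) ⊢ M ∶ • A
    delay-into-union Γ₁ Γ₂ M A valid₁ _ _ d = weaken (⊆-∪ˡ (•ctx Γ₁) Γ₂) (delay Γ₁ valid₁ d)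
    substitute-into-union : ∀ Γ₁ Γ₂ x M N A B → ValidCtx Γ₁ → ValidCtx Γ₂ → Compatible Γ₁ Γ₂ →
      IsType A → Compatible Γ₁ ⟦ x ∶ A ⟧ →
      (Γ₁ ∪ ⟦ x ∶ A ⟧) ⊢ M ∶ B → Γ₂ ⊢ N ∶ A → (Γ₁ ∪ Γ₂) ⊢ substTm x N M ∶ B
    substitute-into-union Γ₁ Γ₂ x M N A B valid₁ valid₂ compat _ compatₓ d dN =
      substitution Γ₁ (Γ₁ ∪ Γ₂) (⊆-∪ˡ Γ₁ Γ₂) (valid-∪ Γ₁ Γ₂ valid₁ valid₂) compatₓ d
                   (weaken (⊆-∪ʳ Γ₁ Γ₂ compat) dN)
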